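{- For every complete $k$-partite graph $K_{r_1,\ldots,r_k}$ with $k\ge3$ and $r_j\ne3$, $r_j\ge2$ for all $j=1,\ldots,k$, we have $\chi_g(K_{r_1,\ldots,r_k})\ge\min\{2k-1,\ \sum_{i=1}^k\lceil r_i/2\rceil\}$. Additionally, if $n=\sum_i r_i$ is even, then $\chi_g(K_{r_1,\ldots,r_k})\ge 2k-1$.
   Context: Graph coloring game: given a graph $G$ and a finite set $C$ of colors, Alice and Bob alternately (Alice first) pick an uncolored vertex and give it a legal color, i.e. a color from $C$ not used on any neighbor. The game ends when all vertices are colored (Alice wins) or when no uncolored vertex has a legal color (Bob wins). The game chromatic number $\chi_g(G)$ is the minimum $|C|$ for which Alice has a winning strategy. $K_{r_1,\ldots,r_k}$ denotes the complete $k$-partite graph with parts (independent sets) $V_1,\ldots,V_k$, $|V_i|=r_i\ge1$, $r_1\ge\cdots\ge r_k$, every two vertices in different parts adjacent; the paper assumes that if $k\ge2$ then $r_1\ge 2$. -}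

module Defs where

open import Data.Nat using (ℕ; zero; suc; _+_; _*_; _∸_; _≤_; _<_; ⌈_/2⌉; _⊓_)
open import Data.Nat.Properties using ()
open import Data.Fin using (Fin)
open import Data.List using (List; map; allFin)
open import Data.Nat.ListAction using (sum)
open import Data.Maybe using (Maybe; just; nothing)
open import Data.Product using (Σ; ∃; ∃-syntax; _×_; _,_)
open import Data.Empty using (⊥)
open import Relation.Nullary using (¬_; yes; no)
open import Relation.Binary.PropositionalEquality using (_≡_; _≢_)
open import Relation.Binary.Definitions using (DecidableEquality)
open import Data.Fin.Properties using () renaming (_≟_ to _≟F_)
open import Data.Product.Properties using (≡-dec)
open import Data.Product using (proj₁)

record Graph : Set₁ where
  field
    V    : Set
    _≟V_ : DecidableEquality V
    Adj  : V → V → Set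

module Game (G : Graph) (c : ℕ) where
  open Graph G

  -- partial coloring: nothing = uncolored
  State : Set
  State = V → Maybe (Fin c)

  emptyState : State
  emptyState _ = nothing

  Legal : State → V → Fin c → Set
  Legal s v a = (s v ≡ nothing) × (∀ u → Adj u v → s u ≢ just a)

  update : State → V → Fin c → State
  update s v a u with u ≟V v
  ... | yes _ = just a
  ... | no  _ = s u

  AllColored : State → Set
  AllColored s = ∀ v → s v ≢ nothing

  data Player : Set where
    alice bob : Player

  -- AliceWins s p : Alice has a winning strategy from state s with p to move.
  -- (The game is finite, so the inductive (least fixed point) reading is
  -- exactly "Alice has a winning strategy".)
  data AliceWins : State → Player → Set where
    finished  : ∀ {s p} → AllColored s → AliceWins s p
    aliceMove : ∀ {s} (v : V) (a : Fin c) → Legal s v a →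
                AliceWins (update s v a) bob → AliceWins s alice
    bobMove   : ∀ {s} →
                (∃[ v ] ∃[ a ] Legal s v a) →
                (∀ v a → Legal s v a → AliceWins (update s v a) alice) →
                AliceWins s bob

  AliceWinsGame : Set
  AliceWinsGame = AliceWins emptyState alice

-- χ_g(G) ≥ m  :⇔  Alice has no winning strategy with any c < m colors
χg≥ : Graph → ℕ → Set
χg≥ G m = ∀ c → c < m → ¬ Game.AliceWinsGame G c

completeMultipartite : (k : ℕ) → (Fin k → ℕ) → Graph
completeMultipartite k r = record
  { V    = Σ (Fin k) (λ i → Fin (r i))
  ; _≟V_ = dec
  ; Adj  = λ u v → proj₁ u ≢ proj₁ v
  }
  where
  dec : DecidableEquality (Σ (Fin k) (λ i → Fin (r i)))
  dec = ≡-dec _≟F_ (λ {i} → _≟F_)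

sumFin : (k : ℕ) → (Fin k → ℕ) → ℕ
sumFin k f = sum (map f (allFin k))

{-# OPTIONS --safe #-}

-- Bob always colours with a colour that has not been used before. He answers a move in a
-- started part (one that already contains a coloured vertex) by colouring a free vertex of a
-- started part, or, when none is left, by starting a new part, preferably one whose size is
-- not 2; he answers the start of a new part by colouring a free vertex of a started part.
-- Once all c colours are in use while some part is still uncoloured, that part can never be
-- coloured, since each of its vertices sees every colour. The invariant kept between Alice's
-- moves guarantees that the colours run out before the last part is started: its first
-- clause accounts for the bound 2k - 1, its second one, relevant only when n is odd, for the
-- bound Σ ⌈rᵢ/2⌉. Parts of size 3 are excluded because Bob's answer to
-- Alice opening one may leave her a single free vertex in the started parts.

module Submission where

open import Defs
open import Data.Nat using (ℕ; zero; suc; _+_; _*_; _∸_; _≤_; _<_; z≤n; s≤s; _⊓_; ⌈_/2⌉; ⌊_/2⌋; _≟_; _<?_)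
open import Data.Nat.Properties
open import Data.Nat.Divisibility using (_∣_; divides; ∣-refl; ∣m+n∣m⇒∣n)
open import Data.Fin using (Fin; zero; suc; punchIn; fromℕ<)
open import Data.Fin.Properties using (any?; punchInᵢ≢i) renaming (_≟_ to _≟F_)
open import Data.List using (tabulate)
open import Data.List.Properties using (map-tabulate)
import Data.Nat.ListAction as List
open import Data.Maybe using (Maybe; just; nothing)
open import Data.Maybe.Properties using (just-injective)
open import Data.Product using (∃-syntax; _×_; _,_; proj₁)
open import Data.Sum using (_⊎_; inj₁; inj₂)
open import Function using (_∘_)
open import Relation.Nullary using (¬_; yes; no; contradiction)
open import Relation.Nullary.Decidable using (_×-dec_; ¬?)
open import Relation.Binary.PropositionalEquality
open import Data.Nat.Tactic.RingSolver using (solve-∀)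
open import Algebra.Properties.CommutativeMonoid.Sum +-0-commutativeMonoid
  using (sum; sum-cong-≗; sum-replicate-zero; sum-remove; ∑-distrib-+)
open import Algebra.Properties.Semiring.Sum +-*-semiring using (*-distribˡ-sum)

sumFin≡sum : ∀ n (f : Fin n → ℕ) → sumFin n f ≡ sum f
sumFin≡sum n f = trans (cong List.sum (map-tabulate (λ x → x) f)) (sum-tabulate n f)
  where
  sum-tabulate : ∀ n (f : Fin n → ℕ) → List.sum (tabulate f) ≡ sum f
  sum-tabulate zero    f = refl
  sum-tabulate (suc n) f = cong (f zero +_) (sum-tabulate n (f ∘ suc))

sum-mono-≤ : ∀ {n} {f g : Fin n → ℕ} → (∀ x → f x ≤ g x) → sum f ≤ sum g
sum-mono-≤ {zero}  f≤g = z≤n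
sum-mono-≤ {suc n} f≤g = +-mono-≤ (f≤g zero) (sum-mono-≤ (f≤g ∘ suc))

≤-sum : ∀ {n} (f : Fin n → ℕ) x → f x ≤ sum f
≤-sum f zero    = m≤m+n _ _
≤-sum f (suc x) = ≤-trans (≤-sum (f ∘ suc) x) (m≤n+m _ _)

sum≡0⇒≡0 : ∀ {n} (f : Fin n → ℕ) → sum f ≡ 0 → ∀ x → f x ≡ 0
sum≡0⇒≡0 f Σf≡0 x = n≤0⇒n≡0 (subst (f x ≤_) Σf≡0 (≤-sum f x))

sum-const : ∀ n (a : ℕ) → sum {n} (λ _ → a) ≡ n * a
sum-const zero    a = refl
sum-const (suc n) a = cong (a +_) (sum-const n a)

0<sum⇒∃0< : ∀ {n} (f : Fin n → ℕ) → 0 < sum f → ∃[ x ] 0 < f x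
0<sum⇒∃0< {n} f 0<Σf with any? (λ x → 0 <? f x)
... | yes found = found
... | no  none  = contradiction 0<Σf (≤⇒≯ (begin
  sum f              ≤⟨ sum-mono-≤ (λ x → ≮⇒≥ (λ 0<fx → none (x , 0<fx))) ⟩
  sum {n} (λ _ → 0)  ≡⟨ sum-replicate-zero n ⟩
  0                  ∎))
  where open ≤-Reasoning

sum-exchange : ∀ {n} (f g : Fin n → ℕ) y → (∀ x → x ≢ y → f x ≡ g x) →
               sum g + f y ≡ sum f + g y
sum-exchange {suc n} f g y f≡g = begin
  sum g + f y                          ≡⟨ cong (_+ f y) (sum-remove {i = y} g) ⟩
  g y + sum (g ∘ punchIn y) + f y      ≡⟨ cong (λ z → g y + z + f y) rest ⟩
  g y + sum (f ∘ punchIn y) + f y      ≡⟨ swap (g y) _ (f y) ⟩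
  f y + sum (f ∘ punchIn y) + g y      ≡⟨ cong (_+ g y) (sum-remove {i = y} f) ⟨
  sum f + g y                          ∎
  where
  open ≡-Reasoning
  rest : sum (g ∘ punchIn y) ≡ sum (f ∘ punchIn y)
  rest = sum-cong-≗ (λ x → sym (f≡g (punchIn y x) (punchInᵢ≢i y x)))
  swap : ∀ a b c → a + b + c ≡ c + b + a
  swap = solve-∀

sum-increase-at : ∀ {n} (f g : Fin n → ℕ) y {δ} → (∀ x → x ≢ y → f x ≡ g x) →
                  g y ≡ f y + δ → sum g ≡ sum f + δ
sum-increase-at f g y {δ} f≡g gy≡fy+δ = +-cancelʳ-≡ (f y) _ _ (begin
  sum g + f y        ≡⟨ sum-exchange f g y f≡g ⟩
  sum f + g y        ≡⟨ cong (sum f +_) (trans gy≡fy+δ (+-comm (f y) δ)) ⟩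
  sum f + (δ + f y)  ≡⟨ +-assoc (sum f) δ (f y) ⟨
  sum f + δ + f y    ∎)
  where open ≡-Reasoning

sum≤n : ∀ {n} (f : Fin n → ℕ) → (∀ x → f x ≤ 1) → sum f ≤ n
sum≤n {n} f f≤1 = ≤-trans (sum-mono-≤ f≤1) (≤-reflexive (trans (sum-const n 1) (*-identityʳ n)))

sum<n⇒∃≡0 : ∀ {n} (f : Fin n → ℕ) → (∀ x → f x ≤ 1) → sum f < n → ∃[ x ] f x ≡ 0
sum<n⇒∃≡0 {n} f _ Σf<n with any? (λ x → f x ≟ 0)
... | yes found = found
... | no  none  = contradiction Σf<n (≤⇒≯ (begin
  n                  ≡⟨ trans (sum-const n 1) (*-identityʳ n) ⟨
  sum {n} (λ _ → 1)  ≤⟨ sum-mono-≤ (λ x → n≢0⇒n>0 (λ fx≡0 → none (x , fx≡0))) ⟩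
  sum f              ∎))
  where open ≤-Reasoning

≡0⇒sum<n : ∀ {n} (f : Fin n → ℕ) → (∀ x → f x ≤ 1) → ∀ y → f y ≡ 0 → sum f < n
≡0⇒sum<n {suc n} f f≤1 y fy≡0 = s≤s (begin
  sum f                    ≡⟨ sum-remove {i = y} f ⟩
  f y + sum (f ∘ punchIn y) ≡⟨ cong (_+ sum (f ∘ punchIn y)) fy≡0 ⟩
  sum (f ∘ punchIn y)      ≤⟨ sum≤n (f ∘ punchIn y) (f≤1 ∘ punchIn y) ⟩
  n                        ∎)
  where open ≤-Reasoning

⌊m/2⌋+⌈n/2⌉≤1+⌊m+n/2⌋ : ∀ m n → ⌊ m /2⌋ + ⌈ n /2⌉ ≤ suc ⌊ m + n /2⌋
⌊m/2⌋+⌈n/2⌉≤1+⌊m+n/2⌋ zero          zero          = z≤n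
⌊m/2⌋+⌈n/2⌉≤1+⌊m+n/2⌋ zero          (suc zero)    = s≤s z≤n
⌊m/2⌋+⌈n/2⌉≤1+⌊m+n/2⌋ zero          (suc (suc n)) = s≤s (⌊m/2⌋+⌈n/2⌉≤1+⌊m+n/2⌋ zero n)
⌊m/2⌋+⌈n/2⌉≤1+⌊m+n/2⌋ (suc zero)    n             = n≤1+n _
⌊m/2⌋+⌈n/2⌉≤1+⌊m+n/2⌋ (suc (suc m)) n             = s≤s (⌊m/2⌋+⌈n/2⌉≤1+⌊m+n/2⌋ m n)

2∤1+2n : ∀ n → ¬ 2 ∣ suc (2 * n)
2∤1+2n n (divides q eq) = even≢odd q n (trans (*-comm 2 q) (sym eq))

2∤n⇒2∤2+n : ∀ {n} → ¬ 2 ∣ n → ¬ 2 ∣ 2 + n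
2∤n⇒2∤2+n 2∤n 2∣2+n = 2∤n (∣m+n∣m⇒∣n 2∣2+n ∣-refl)

-- 1 if a single free vertex is left in the started parts while at least two parts are
-- uncoloured: once Alice takes it, Bob has to start a part himself.
loneFree : ℕ → ℕ → ℕ
loneFree 1 (suc (suc _)) = 1
loneFree _ _             = 0

loneFree≤1 : ∀ f t → loneFree f t ≤ 1
loneFree≤1 zero          t             = z≤n
loneFree≤1 (suc zero)    zero          = z≤n
loneFree≤1 (suc zero)    (suc zero)    = z≤n
loneFree≤1 (suc zero)    (suc (suc t)) = ≤-refl
loneFree≤1 (suc (suc f)) t             = z≤n

loneFree[f,1]≡0 : ∀ f → loneFree f 1 ≡ 0
loneFree[f,1]≡0 zero          = refl
loneFree[f,1]≡0 (suc zero)    = refl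
loneFree[f,1]≡0 (suc (suc f)) = refl

loneFree[1,1+t]≤t : ∀ t → loneFree 1 (suc t) ≤ t
loneFree[1,1+t]≤t zero    = z≤n
loneFree[1,1+t]≤t (suc t) = s≤s z≤n

loneFree[f+q,t]≤loneFree[f,1+t] : ∀ f t q → 1 ≤ t → q ≢ 1 → loneFree (f + q) t ≤ loneFree f (suc t)
loneFree[f+q,t]≤loneFree[f,1+t] zero          _             zero          _ _   = z≤n
loneFree[f+q,t]≤loneFree[f,1+t] zero          _             (suc zero)    _ q≢1 = contradiction refl q≢1
loneFree[f+q,t]≤loneFree[f,1+t] zero          _             (suc (suc _)) _ _   = z≤n
loneFree[f+q,t]≤loneFree[f,1+t] (suc zero)    (suc zero)    zero          _ _   = z≤n
loneFree[f+q,t]≤loneFree[f,1+t] (suc zero)    (suc (suc _)) zero          _ _   = ≤-refl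
loneFree[f+q,t]≤loneFree[f,1+t] (suc zero)    _             (suc _)       _ _   = z≤n
loneFree[f+q,t]≤loneFree[f,1+t] (suc (suc _)) _             _             _ _   = z≤n

-- The numbers the invariant tracks for a position: d colours used, t uncoloured parts,
-- f free vertices in started parts, h the sum of ⌈size/2⌉ over uncoloured parts, and
-- m uncoloured vertices.
record Stats : Set where
  constructor mkStats
  field
    d t f h m : ℕ

open Stats

record StartedStep (σ σ' : Stats) : Set where
  field
    t-same : t σ' ≡ t σ
    f-dec  : suc (f σ') ≡ f σ
    h-same : h σ' ≡ h σ
    m-dec  : suc (m σ') ≡ m σ
    d-mono : d σ ≤ d σ'

record StartingStep (size : ℕ) (σ σ' : Stats) : Set where
  field
    t-dec : suc (t σ') ≡ t σ
    f-inc : f σ' ≡ f σ + (size ∸ 1)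
    h-dec : h σ' + ⌈ size /2⌉ ≡ h σ
    m-dec : suc (m σ') ≡ m σ
    d-inc : d σ' ≡ suc (d σ)

module RoundInvariant (c : ℕ) where

  record Invariant (σ : Stats) : Set where
    field
      some-unstarted : 1 ≤ t σ
      colour-bound   : suc c + loneFree (f σ) (t σ) < d σ + t σ + t σ
      parity-bound   : ¬ 2 ∣ m σ → c < d σ + h σ + ⌊ f σ /2⌋

  open Invariant

  private
    +-monoˡ-≤² : ∀ {d d'} a b → d ≤ d' → d + a + b ≤ d' + a + b
    +-monoˡ-≤² a b d≤d' = +-monoˡ-≤ b (+-monoˡ-≤ a d≤d')

  invariant-final : ∀ {σ} → Invariant σ → t σ ≡ 1 → ¬ d σ < c
  invariant-final {mkStats d _ f _ _} inv refl d<c = <-irrefl refl (begin-strict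
    suc c                ≡⟨ +-identityʳ (suc c) ⟨
    suc c + 0            ≡⟨ cong (suc c +_) (loneFree[f,1]≡0 f) ⟨
    suc c + loneFree f 1 <⟨ colour-bound inv ⟩
    d + 1 + 1            ≡⟨ cong (_+ 1) (+-comm d 1) ⟩
    suc d + 1            ≡⟨ +-comm (suc d) 1 ⟩
    suc (suc d)          ≤⟨ s≤s d<c ⟩
    suc c                ∎)
    where open ≤-Reasoning

  invariant-inStarted-inStarted : ∀ {σ σ₁ σ₂} → Invariant σ → StartedStep σ σ₁ → StartedStep σ₁ σ₂ →
                                  d σ₂ ≡ suc (d σ₁) → Invariant σ₂
  invariant-inStarted-inStarted {mkStats d _ _ _ _} {mkStats d₁ _ _ _ _} {mkStats _ t f h _} inv
    record { t-same = refl ; f-dec = refl ; h-same = refl ; m-dec = refl ; d-mono = d≤d₁ }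
    record { t-same = refl ; f-dec = refl ; h-same = refl ; m-dec = refl } refl = record
    { some-unstarted = some-unstarted inv
    ; colour-bound   = begin-strict
        suc c + loneFree f t  ≤⟨ +-monoʳ-≤ (suc c) (loneFree≤1 f t) ⟩
        suc c + 1             ≡⟨ +-comm (suc c) 1 ⟩
        suc (suc c)           ≡⟨ cong suc (+-identityʳ (suc c)) ⟨
        suc (suc c + 0)       ≤⟨ colour-bound inv ⟩
        d + t + t             <⟨ n<1+n _ ⟩
        suc d + t + t         ≤⟨ +-monoˡ-≤² t t (s≤s d≤d₁) ⟩
        suc d₁ + t + t        ∎
    ; parity-bound   = λ 2∤m → begin-strict
        c                     <⟨ parity-bound inv (2∤n⇒2∤2+n 2∤m) ⟩
        d + h + suc ⌊ f /2⌋   ≡⟨ +-suc (d + h) _ ⟩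
        suc d + h + ⌊ f /2⌋   ≤⟨ +-monoˡ-≤² h _ (s≤s d≤d₁) ⟩
        suc d₁ + h + ⌊ f /2⌋  ∎
    }
    where open ≤-Reasoning

  invariant-lastFree-newPart : ∀ {σ σ₁ σ₂ r} → Invariant σ → StartedStep σ σ₁ → f σ₁ ≡ 0 → 2 ≤ t σ →
                               StartingStep r σ₁ σ₂ → 2 ≤ r → r ≢ 2 → Invariant σ₂
  invariant-lastFree-newPart {r = suc zero}       _ _ _ _ _ (s≤s ()) _
  invariant-lastFree-newPart {r = suc (suc zero)} _ _ _ _ _ _ r≢2 = contradiction refl r≢2
  invariant-lastFree-newPart {mkStats d _ _ _ _} {mkStats d₁ _ _ _ _} {mkStats _ (suc u) _ h _}
    {suc (suc (suc q))} inv
    record { t-same = refl ; f-dec = refl ; h-same = refl ; m-dec = refl ; d-mono = d≤d₁ } refl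
    (s≤s (s≤s _))
    record { t-dec = refl ; f-inc = refl ; h-dec = refl ; m-dec = refl ; d-inc = refl } _ _ = record
    { some-unstarted = s≤s z≤n
    ; colour-bound   = begin-strict
        suc c + 0               ≡⟨ +-identityʳ (suc c) ⟩
        suc c                   <⟨ m<m+n (suc c) (s≤s z≤n) ⟩
        suc c + 1               ≤⟨ ≤-pred (≤-trans (colour-bound inv) (≤-reflexive (drop2 d u))) ⟩
        suc d + suc u + suc u   ≤⟨ +-monoˡ-≤² (suc u) (suc u) (s≤s d≤d₁) ⟩
        suc d₁ + suc u + suc u  ∎
    ; parity-bound   = λ 2∤m → begin-strict
        c                                   <⟨ parity-bound inv (2∤n⇒2∤2+n 2∤m) ⟩
        d + (h + suc (suc ⌊ q /2⌋)) + 0     ≡⟨ regroup d h ⌊ q /2⌋ ⟩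
        suc d + h + suc ⌊ q /2⌋             ≤⟨ +-monoˡ-≤² h _ (s≤s d≤d₁) ⟩
        suc d₁ + h + suc ⌊ q /2⌋            ∎
    }
    where
    open ≤-Reasoning
    drop2 : ∀ d u → d + suc (suc u) + suc (suc u) ≡ suc (suc d + suc u + suc u)
    drop2 = solve-∀
    regroup : ∀ d h x → d + (h + suc (suc x)) + 0 ≡ suc d + h + suc x
    regroup = solve-∀

  invariant-lastFree-newPair : ∀ {σ σ₁ σ₂} → Invariant σ → StartedStep σ σ₁ → f σ₁ ≡ 0 → 2 ≤ t σ →
                               StartingStep 2 σ₁ σ₂ → h σ ≡ t σ → ¬ 2 ∣ m σ → Invariant σ₂
  invariant-lastFree-newPair {mkStats d _ _ _ _} {mkStats d₁ _ _ _ _} {mkStats _ (suc u) _ h _} inv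
    record { t-same = refl ; f-dec = refl ; h-same = refl ; m-dec = refl ; d-mono = d≤d₁ } refl
    (s≤s (s≤s _))
    record { t-dec = refl ; f-inc = refl ; h-dec = h+1≡t ; m-dec = refl ; d-inc = refl } refl 2∤m = record
    { some-unstarted = s≤s z≤n
    ; colour-bound   = begin-strict
        suc c + loneFree 1 (suc u)  ≤⟨ +-mono-≤ (parity-bound inv 2∤m) (loneFree[1,1+t]≤t u) ⟩
        d + suc (suc u) + 0 + u     ≡⟨ regroup d u ⟩
        d + suc u + suc u           <⟨ n<1+n _ ⟩
        suc d + suc u + suc u       ≤⟨ +-monoˡ-≤² (suc u) (suc u) (s≤s d≤d₁) ⟩
        suc d₁ + suc u + suc u      ∎
    ; parity-bound   = λ _ → begin-strict
        c                           <⟨ parity-bound inv 2∤m ⟩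
        d + suc (suc u) + 0         ≡⟨ cong (_+ 0) (+-suc d (suc u)) ⟩
        suc d + suc u + 0           ≤⟨ +-monoˡ-≤² (suc u) 0 (s≤s d≤d₁) ⟩
        suc d₁ + suc u + 0          ≡⟨ cong (λ x → suc d₁ + x + 0) h≡1+u ⟨
        suc d₁ + h + 0              ∎
    }
    where
    open ≤-Reasoning
    h≡1+u : h ≡ suc u
    h≡1+u = suc-injective (trans (+-comm 1 h) h+1≡t)
    regroup : ∀ d u → d + suc (suc u) + 0 + u ≡ d + suc u + suc u
    regroup = solve-∀

  invariant-newPart-inStarted : ∀ {σ σ₁ σ₂ r} → Invariant σ → StartingStep r σ σ₁ → 1 ≤ t σ₁ →
                                StartedStep σ₁ σ₂ → d σ₂ ≡ suc (d σ₁) → 2 ≤ r → r ≢ 3 → Invariant σ₂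
  invariant-newPart-inStarted {mkStats d _ f _ _} {_} {mkStats _ t _ h _} {suc (suc q)} inv
    record { t-dec = refl ; f-inc = refl ; h-dec = refl ; m-dec = refl ; d-inc = refl } 1≤t
    record { t-same = refl ; f-dec = 1+f₂≡f+r-1 ; h-same = refl ; m-dec = refl } refl (s≤s (s≤s _)) r≢3 =
    subst (λ x → Invariant (mkStats (2 + d) t x h _)) (sym f₂≡f+q) (record
      { some-unstarted = 1≤t
      ; colour-bound   = begin-strict
          suc c + loneFree (f + q) t        ≤⟨ +-monoʳ-≤ (suc c) lone≤ ⟩
          suc c + loneFree f (suc t)        <⟨ colour-bound inv ⟩
          d + suc t + suc t                 ≡⟨ shift d t ⟩
          2 + d + t + t                     ∎
      ; parity-bound   = λ 2∤m → begin-strict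
          c                                  <⟨ parity-bound inv (2∤n⇒2∤2+n 2∤m) ⟩
          d + (h + suc ⌈ q /2⌉) + ⌊ f /2⌋   ≡⟨ regroup d h ⌈ q /2⌉ ⌊ f /2⌋ ⟩
          suc d + h + (⌊ f /2⌋ + ⌈ q /2⌉)   ≤⟨ +-monoʳ-≤ (suc d + h) (⌊m/2⌋+⌈n/2⌉≤1+⌊m+n/2⌋ f q) ⟩
          suc d + h + suc ⌊ f + q /2⌋       ≡⟨ +-suc (suc d + h) _ ⟩
          2 + d + h + ⌊ f + q /2⌋           ∎
      })
    where
    open ≤-Reasoning
    lone≤ : loneFree (f + q) t ≤ loneFree f (suc t)
    lone≤ = loneFree[f+q,t]≤loneFree[f,1+t] f t q 1≤t λ { refl → r≢3 refl }
    f₂≡f+q : _ ≡ f + q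
    f₂≡f+q = suc-injective (trans 1+f₂≡f+r-1 (+-suc f q))
    shift : ∀ d t → d + suc t + suc t ≡ 2 + d + t + t
    shift = solve-∀
    regroup : ∀ d h x y → d + (h + suc x) + y ≡ suc d + h + (y + x)
    regroup = solve-∀

module BobStrategy (k : ℕ) (r : Fin k → ℕ) (c : ℕ) where

  open Graph (completeMultipartite k r)
  open Game (completeMultipartite k r) c
  open RoundInvariant c

  isColoured : Maybe (Fin c) → ℕ
  isColoured nothing  = 0
  isColoured (just _) = 1

  isColoured≤1 : ∀ w → isColoured w ≤ 1
  isColoured≤1 nothing  = z≤n
  isColoured≤1 (just _) = s≤s z≤n

  isColoured≡0⇒nothing : ∀ {w} → isColoured w ≡ 0 → w ≡ nothing
  isColoured≡0⇒nothing {nothing} _ = refl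

  hasColour : Fin c → Maybe (Fin c) → ℕ
  hasColour b nothing = 0
  hasColour b (just a) with a ≟F b
  ... | yes _ = 1
  ... | no  _ = 0

  coloured : State → Fin k → ℕ
  coloured s i = sum (λ x → isColoured (s (i , x)))

  uses : State → Fin c → ℕ
  uses s b = sum (λ i → sum (λ x → hasColour b (s (i , x))))

  -- 1 ⊓ u rather than u ⊓ 1, since only the former reduces when u is a successor.
  colours : State → ℕ
  colours s = sum (λ b → 1 ⊓ uses s b)

  partSum : (ℕ → ℕ → ℕ) → State → ℕ
  partSum g s = sum (λ i → g (r i) (coloured s i))

  isUnstarted freeIfStarted halfIfUnstarted : ℕ → ℕ → ℕ
  isUnstarted     _ zero    = 1
  isUnstarted     _ (suc _) = 0
  freeIfStarted   _ zero    = 0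
  freeIfStarted   n (suc m) = n ∸ suc m
  halfIfUnstarted n zero    = ⌈ n /2⌉
  halfIfUnstarted _ (suc _) = 0

  unstartedParts freeInStarted halfUnstarted uncoloured : State → ℕ
  unstartedParts = partSum isUnstarted
  freeInStarted  = partSum freeIfStarted
  halfUnstarted  = partSum halfIfUnstarted
  uncoloured     = partSum _∸_

  stats : State → Stats
  stats s = mkStats (colours s) (unstartedParts s) (freeInStarted s) (halfUnstarted s) (uncoloured s)

  update-same : ∀ s v a → update s v a v ≡ just a
  update-same s v a with v ≟V v
  ... | yes _   = refl
  ... | no  v≢v = contradiction refl v≢v

  update-other : ∀ s v a u → u ≢ v → update s v a u ≡ s u
  update-other s v a u u≢v with u ≟V v
  ... | yes u≡v = contradiction u≡v u≢v
  ... | no  _   = refl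

  hasColour-self : ∀ a → hasColour a (just a) ≡ 1
  hasColour-self a with a ≟F a
  ... | yes _   = refl
  ... | no  a≢a = contradiction refl a≢a

  hasColour-≢ : ∀ {b} w → w ≢ just b → hasColour b w ≡ 0
  hasColour-≢     nothing  _   = refl
  hasColour-≢ {b} (just a) a≢b with a ≟F b
  ... | yes refl = contradiction refl a≢b
  ... | no  _    = refl

  module Colouring (s : State) (j : Fin k) (y : Fin (r j)) (a : Fin c) (free : s (j , y) ≡ nothing) where

    s' : State
    s' = update s (j , y) a

    private
      elsewhere : ∀ i x → i ≢ j → s' (i , x) ≡ s (i , x)
      elsewhere i x i≢j = update-other s (j , y) a (i , x) (i≢j ∘ cong proj₁)

      elsewhereInPart : ∀ x → x ≢ y → s' (j , x) ≡ s (j , x)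
      elsewhereInPart x x≢y = update-other s (j , y) a (j , x) λ { refl → x≢y refl }

      inPart : ∀ (w : Maybe (Fin c) → ℕ) → w nothing ≡ 0 →
               sum (λ x → w (s' (j , x))) ≡ sum (λ x → w (s (j , x))) + w (just a)
      inPart w w0 = sum-increase-at _ _ y (λ x x≢y → cong w (sym (elsewhereInPart x x≢y))) (begin
        w (s' (j , y))              ≡⟨ cong w (update-same s (j , y) a) ⟩
        w (just a)                  ≡⟨ cong (_+ w (just a)) (trans (cong w free) w0) ⟨
        w (s (j , y)) + w (just a)  ∎)
        where open ≡-Reasoning

    coloured<size : coloured s j < r j
    coloured<size = ≡0⇒sum<n _ (λ x → isColoured≤1 (s (j , x))) y (cong isColoured free)

    coloured-other : ∀ i → i ≢ j → coloured s' i ≡ coloured s i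
    coloured-other i i≢j = sum-cong-≗ λ x → cong isColoured (elsewhere i x i≢j)

    coloured-same : coloured s' j ≡ suc (coloured s j)
    coloured-same = trans (inPart isColoured refl) (+-comm (coloured s j) 1)

    partSum-step : ∀ g {m} → coloured s j ≡ m → partSum g s' + g (r j) m ≡ partSum g s + g (r j) (suc m)
    partSum-step g refl = subst (λ n → partSum g s' + g (r j) (coloured s j) ≡ partSum g s + g (r j) n)
      coloured-same
      (sum-exchange _ _ j λ i i≢j → cong (g (r i)) (sym (coloured-other i i≢j)))

    uses-update : ∀ b → uses s' b ≡ uses s b + hasColour b (just a)
    uses-update b = sum-increase-at _ _ j
      (λ i i≢j → sum-cong-≗ λ x → cong (hasColour b) (sym (elsewhere i x i≢j)))
      (inPart (hasColour b) refl)

    private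
      colours-increase : ∀ {δ} → 1 ⊓ (uses s a + 1) ≡ 1 ⊓ uses s a + δ → colours s' ≡ colours s + δ
      colours-increase at-a = sum-increase-at _ _ a others
        (trans (cong (1 ⊓_) (trans (uses-update a) (cong (uses s a +_) (hasColour-self a)))) at-a)
        where
        others : ∀ b → b ≢ a → 1 ⊓ uses s b ≡ 1 ⊓ uses s' b
        others b b≢a = cong (1 ⊓_) (sym (begin
          uses s' b                       ≡⟨ uses-update b ⟩
          uses s b + hasColour b (just a) ≡⟨ cong (uses s b +_) (hasColour-≢ (just a) a≢b) ⟩
          uses s b + 0                    ≡⟨ +-identityʳ _ ⟩
          uses s b                        ∎))
          where
          open ≡-Reasoning
          a≢b = b≢a ∘ sym ∘ just-injective

    colours-fresh : uses s a ≡ 0 → colours s' ≡ suc (colours s)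
    colours-fresh unused =
      trans (colours-increase (subst (λ u → 1 ⊓ (u + 1) ≡ 1 ⊓ u + 1) (sym unused) refl))
            (+-comm (colours s) 1)

    colours-reused : ∀ {m} → uses s a ≡ suc m → colours s' ≡ colours s
    colours-reused used =
      trans (colours-increase (subst (λ u → 1 ⊓ (u + 1) ≡ 1 ⊓ u + 0) (sym used) refl))
            (+-identityʳ (colours s))

    colours-mono : colours s ≤ colours s'
    colours-mono with uses s a in eq
    ... | zero  = ≤-trans (n≤1+n _) (≤-reflexive (sym (colours-fresh eq)))
    ... | suc m = ≤-reflexive (sym (colours-reused eq))

    private
      cancel-∸-suc : ∀ {x z n m} → m < n → x + (n ∸ m) ≡ z + (n ∸ suc m) → suc x ≡ z
      cancel-∸-suc {x} {z} {n} {m} m<n eq = +-cancelʳ-≡ (n ∸ suc m) _ _ (begin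
        suc x + (n ∸ suc m)  ≡⟨ +-suc x _ ⟨
        x + suc (n ∸ suc m)  ≡⟨ cong (x +_) (+-∸-assoc 1 m<n) ⟨
        x + (n ∸ m)          ≡⟨ eq ⟩
        z + (n ∸ suc m)      ∎)
        where open ≡-Reasoning

    uncoloured-dec : suc (uncoloured s') ≡ uncoloured s
    uncoloured-dec = cancel-∸-suc coloured<size (partSum-step _∸_ refl)

    startedStep : ∀ {m} → coloured s j ≡ suc m → StartedStep (stats s) (stats s')
    startedStep started = record
      { t-same = +-cancelʳ-≡ 0 _ _ (partSum-step isUnstarted started)
      ; f-dec  = cancel-∸-suc (subst (_< r j) started coloured<size) (partSum-step freeIfStarted started)
      ; h-same = +-cancelʳ-≡ 0 _ _ (partSum-step halfIfUnstarted started)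
      ; m-dec  = uncoloured-dec
      ; d-mono = colours-mono
      }

    startingStep : coloured s j ≡ 0 → uses s a ≡ 0 → StartingStep (r j) (stats s) (stats s')
    startingStep unstarted unused = record
      { t-dec = trans (+-comm 1 _) (trans (partSum-step isUnstarted unstarted) (+-identityʳ _))
      ; f-inc = trans (sym (+-identityʳ _)) (partSum-step freeIfStarted unstarted)
      ; h-dec = trans (partSum-step halfIfUnstarted unstarted) (+-identityʳ _)
      ; m-dec = uncoloured-dec
      ; d-inc = colours-fresh unused
      }

  colours≤c : ∀ s → colours s ≤ c
  colours≤c s = sum≤n _ (λ b → m⊓n≤m 1 (uses s b))

  colours<c⇒fresh : ∀ s → colours s < c → ∃[ b ] uses s b ≡ 0
  colours<c⇒fresh s d<c with sum<n⇒∃≡0 _ (λ b → m⊓n≤m 1 (uses s b)) d<c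
  ... | b , 1⊓u≡0 = b , unused (uses s b) 1⊓u≡0
    where
    unused : ∀ u → 1 ⊓ u ≡ 0 → u ≡ 0
    unused zero _ = refl

  colours≡c⇒used : ∀ s → colours s ≡ c → ∀ b → ∃[ m ] uses s b ≡ suc m
  colours≡c⇒used s d≡c b with uses s b in eq
  ... | suc m = m , refl
  ... | zero  = contradiction d≡c (<⇒≢ (≡0⇒sum<n _ (λ b' → m⊓n≤m 1 (uses s b')) b (cong (1 ⊓_) eq)))

  unused⇒absent : ∀ s b → uses s b ≡ 0 → ∀ u → s u ≢ just b
  unused⇒absent s b unused (i , x) su≡b = contradiction (begin
    1                         ≡⟨ hasColour-self b ⟨
    hasColour b (just b)      ≡⟨ cong (hasColour b) su≡b ⟨
    hasColour b (s (i , x))   ≡⟨ sum≡0⇒≡0 _ (sum≡0⇒≡0 _ unused i) x ⟩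
    0                         ∎) λ ()
    where open ≡-Reasoning

  fresh⇒legal : ∀ s v b → s v ≡ nothing → uses s b ≡ 0 → Legal s v b
  fresh⇒legal s v b free unused = free , λ u _ → unused⇒absent s b unused u

  unstarted⇒free : ∀ s j → coloured s j ≡ 0 → ∀ x → s (j , x) ≡ nothing
  unstarted⇒free s j unstarted x = isColoured≡0⇒nothing (sum≡0⇒≡0 _ unstarted x)

  startingColour-fresh : ∀ s j y a → coloured s j ≡ 0 → Legal s (j , y) a → uses s a ≡ 0
  startingColour-fresh s j y a unstarted (_ , notAdjacent) = trans
    (sum-cong-≗ λ i → trans (sum-cong-≗ λ x → absent i x) (sum-replicate-zero (r i)))
    (sum-replicate-zero k)
    where
    absent : ∀ i x → hasColour a (s (i , x)) ≡ 0
    absent i x with i ≟F j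
    ... | yes refl = cong (hasColour a) (unstarted⇒free s j unstarted x)
    ... | no  i≢j  = hasColour-≢ (s (i , x)) (notAdjacent (i , x) i≢j)

  someUnstarted : ∀ s → 1 ≤ unstartedParts s → ∃[ j ] coloured s j ≡ 0
  someUnstarted s 1≤T with 0<sum⇒∃0< _ 1≤T
  ... | j , 0<w = j , unstarted (coloured s j) 0<w
    where
    unstarted : ∀ m → 0 < isUnstarted (r j) m → m ≡ 0
    unstarted zero _ = refl

  someFreeInStarted : ∀ s → 1 ≤ freeInStarted s →
                      ∃[ j ] ∃[ y ] ∃[ m ] coloured s j ≡ suc m × s (j , y) ≡ nothing
  someFreeInStarted s 1≤F with 0<sum⇒∃0< _ 1≤F
  ... | j , 0<w with coloured s j in eq
  ... | suc m with sum<n⇒∃≡0 _ (λ x → isColoured≤1 (s (j , x))) (subst (_< r j) (sym eq) m<r)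
    where m<r = m∸n≢0⇒n<m (λ r∸m≡0 → <⇒≢ 0<w (sym r∸m≡0))
  ... | y , y-uncoloured = j , y , m , eq , isColoured≡0⇒nothing y-uncoloured

  module AllUnstartedArePairs (s : State) (pairs : ∀ i → coloured s i ≡ 0 → r i ≡ 2) where

    halfUnstarted≡unstartedParts : halfUnstarted s ≡ unstartedParts s
    halfUnstarted≡unstartedParts = sum-cong-≗ λ i → pointwise i (coloured s i) refl
      where
      pointwise : ∀ i m → coloured s i ≡ m → halfIfUnstarted (r i) m ≡ isUnstarted (r i) m
      pointwise i zero    unstarted = cong ⌈_/2⌉ (pairs i unstarted)
      pointwise i (suc m) _         = refl

    uncoloured≡free+2*unstarted : uncoloured s ≡ freeInStarted s + 2 * unstartedParts s
    uncoloured≡free+2*unstarted = begin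
      uncoloured s                           ≡⟨ sum-cong-≗ (λ i → pointwise i (coloured s i) refl) ⟩
      sum (λ i → free i + 2 * unstarted i)   ≡⟨ ∑-distrib-+ free (λ i → 2 * unstarted i) ⟩
      sum free + sum (λ i → 2 * unstarted i) ≡⟨ cong (sum free +_) (*-distribˡ-sum 2 unstarted) ⟨
      sum free + 2 * sum unstarted           ∎
      where
      open ≡-Reasoning
      free unstarted : Fin k → ℕ
      free      i = freeIfStarted (r i) (coloured s i)
      unstarted i = isUnstarted (r i) (coloured s i)
      pointwise : ∀ i m → coloured s i ≡ m → r i ∸ m ≡ freeIfStarted (r i) m + 2 * isUnstarted (r i) m
      pointwise i zero    unstarted = pairs i unstarted
      pointwise i (suc m) _         = sym (+-identityʳ _)

  bobInStarted : ∀ s → 1 ≤ freeInStarted s → colours s < c →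
                 ∃[ v ] ∃[ b ] Legal s v b × StartedStep (stats s) (stats (update s v b))
                               × colours (update s v b) ≡ suc (colours s)
  bobInStarted s 1≤f d<c with someFreeInStarted s 1≤f | colours<c⇒fresh s d<c
  ... | j , y , m , started , free | b , unused =
    (j , y) , b , fresh⇒legal s (j , y) b free unused , startedStep started , colours-fresh unused
    where open Colouring s j y b free

  bobStarts : ∀ s j y → coloured s j ≡ 0 → colours s < c →
              ∃[ b ] Legal s (j , y) b × StartingStep (r j) (stats s) (stats (update s (j , y) b))
  bobStarts s j y unstarted d<c with colours<c⇒fresh s d<c
  ... | b , unused = b , fresh⇒legal s (j , y) b free unused , startingStep unstarted unused
    where
    free = unstarted⇒free s j unstarted y
    open Colouring s j y b free

  coloured-empty : ∀ i → coloured emptyState i ≡ 0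
  coloured-empty i = sum-replicate-zero (r i)

  partSum-empty : ∀ g → partSum g emptyState ≡ sum (λ i → g (r i) 0)
  partSum-empty g = sum-cong-≗ λ i → cong (g (r i)) (coloured-empty i)

  stats-empty : stats emptyState ≡ mkStats 0 k 0 (sum (λ i → ⌈ r i /2⌉)) (sum r)
  stats-empty = mkStats≡ colours-empty
    (trans (partSum-empty isUnstarted) (trans (sum-const k 1) (*-identityʳ k)))
    (trans (partSum-empty freeIfStarted) (sum-replicate-zero k))
    (partSum-empty halfIfUnstarted)
    (partSum-empty _∸_)
    where
    colours-empty : colours emptyState ≡ 0
    colours-empty = trans (sum-cong-≗ {c} λ b → cong (1 ⊓_) (uses-empty b)) (sum-replicate-zero c)
      where
      uses-empty : ∀ b → uses emptyState b ≡ 0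
      uses-empty b = trans (sum-cong-≗ {k} λ i → sum-replicate-zero (r i)) (sum-replicate-zero k)
    mkStats≡ : ∀ {d d' t t' f f' h h' m m'} → d ≡ d' → t ≡ t' → f ≡ f' → h ≡ h' → m ≡ m' →
               mkStats d t f h m ≡ mkStats d' t' f' h' m'
    mkStats≡ refl refl refl refl refl = refl

  module Winning (r≥2 : ∀ j → 2 ≤ r j) (r≢3 : ∀ j → r j ≢ 3) where

    InvariantAt : State → Set
    InvariantAt s = Invariant (stats s)

    aVertex : ∀ j → Fin (r j)
    aVertex j = fromℕ< (r≥2 j)

    unfinished : ∀ s → 1 ≤ unstartedParts s → ¬ AllColored s
    unfinished s 1≤t allColoured with someUnstarted s 1≤t
    ... | j , unstarted = allColoured (j , aVertex j) (unstarted⇒free s j unstarted (aVertex j))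

    exhausted-persists : ∀ s {j y a} → colours s ≡ c → 1 ≤ unstartedParts s → Legal s (j , y) a →
                         colours (update s (j , y) a) ≡ c × 1 ≤ unstartedParts (update s (j , y) a)
    exhausted-persists s {j} {y} {a} d≡c 1≤t legal@(free , _)
      with colours≡c⇒used s d≡c a | coloured s j in eq
    ... | _ , used | zero  = contradiction (trans (sym used) (startingColour-fresh s j y a eq legal)) λ ()
    ... | _ , used | suc _ =
      trans (colours-reused used) d≡c , subst (1 ≤_) (sym (StartedStep.t-same (startedStep eq))) 1≤t
      where open Colouring s j y a free

    bobHasWon : ∀ {s p} → colours s ≡ c → 1 ≤ unstartedParts s → ¬ AliceWins s p
    bobHasWon {s} d≡c 1≤t (finished allColoured) = unfinished s 1≤t allColoured
    bobHasWon {s} d≡c 1≤t (aliceMove (j , y) a legal next) with exhausted-persists s d≡c 1≤t legal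
    ... | d≡c' , 1≤t' = bobHasWon d≡c' 1≤t' next
    bobHasWon {s} d≡c 1≤t (bobMove ((j , y) , a , legal) respond) with exhausted-persists s d≡c 1≤t legal
    ... | d≡c' , 1≤t' = bobHasWon d≡c' 1≤t' (respond (j , y) a legal)

    BobKeepsInvariant : State → Set
    BobKeepsInvariant s₁ = ∃[ v ] ∃[ b ] Legal s₁ v b × InvariantAt (update s₁ v b)

    replyWithPair : ∀ {s s₁} → InvariantAt s → StartedStep (stats s) (stats s₁) → freeInStarted s₁ ≡ 0 →
                    2 ≤ unstartedParts s → (∀ i → coloured s₁ i ≡ 0 → r i ≡ 2) → colours s₁ < c →
                    BobKeepsInvariant s₁
    replyWithPair {s} {s₁} inv A f₁≡0 2≤t pairs d₁<c
      with someUnstarted s₁ (subst (1 ≤_) (sym (StartedStep.t-same A)) (Invariant.some-unstarted inv))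
    ... | j , unstarted with bobStarts s₁ j (aVertex j) unstarted d₁<c
    ...   | b , legal , B = (j , aVertex j) , b , legal ,
      invariant-lastFree-newPair inv A f₁≡0 2≤t B₂ h≡t 2∤m
      where
      B₂ = subst (λ n → StartingStep n (stats s₁) (stats (update s₁ (j , aVertex j) b))) (pairs j unstarted) B
      open AllUnstartedArePairs s₁ pairs
      open ≡-Reasoning
      h≡t : halfUnstarted s ≡ unstartedParts s
      h≡t = trans (sym (StartedStep.h-same A)) (trans halfUnstarted≡unstartedParts (StartedStep.t-same A))
      m≡1+2t₁ : uncoloured s ≡ suc (2 * unstartedParts s₁)
      m≡1+2t₁ = begin
        uncoloured s                          ≡⟨ StartedStep.m-dec A ⟨
        suc (uncoloured s₁)                   ≡⟨ cong suc uncoloured≡free+2*unstarted ⟩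
        suc (freeInStarted s₁ + 2 * t₁)       ≡⟨ cong (λ f₁ → suc (f₁ + 2 * t₁)) f₁≡0 ⟩
        suc (2 * t₁)                          ∎
        where t₁ = unstartedParts s₁
      2∤m : ¬ 2 ∣ uncoloured s
      2∤m = subst (λ n → ¬ 2 ∣ n) (sym m≡1+2t₁) (2∤1+2n (unstartedParts s₁))

    replyToStarted : ∀ {s s₁} → InvariantAt s → StartedStep (stats s) (stats s₁) → colours s₁ < c →
                     BobKeepsInvariant s₁
    replyToStarted {s} {s₁} inv A d₁<c with freeInStarted s₁ ≟ 0 | unstartedParts s ≟ 1
    ... | no f₁≢0 | _ with bobInStarted s₁ (n≢0⇒n>0 f₁≢0) d₁<c
    ...   | v , b , legal , B , fresh = v , b , legal , invariant-inStarted-inStarted inv A B fresh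
    replyToStarted inv A d₁<c | yes _ | yes t≡1 =
      contradiction (≤-<-trans (StartedStep.d-mono A) d₁<c) (invariant-final inv t≡1)
    replyToStarted {s} {s₁} inv A d₁<c | yes f₁≡0 | no t≢1
      with any? (λ i → (coloured s₁ i ≟ 0) ×-dec ¬? (r i ≟ 2))
    ... | yes (j , unstarted , r≢2) with bobStarts s₁ j (aVertex j) unstarted d₁<c
    ...   | b , legal , B = (j , aVertex j) , b , legal ,
                            invariant-lastFree-newPart inv A f₁≡0 2≤t B (r≥2 j) r≢2
      where 2≤t = ≤∧≢⇒< (Invariant.some-unstarted inv) (t≢1 ∘ sym)
    replyToStarted {s} {s₁} inv A d₁<c | yes f₁≡0 | no t≢1 | no noOtherSize =
      replyWithPair inv A f₁≡0 2≤t pairs d₁<c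
      where
      2≤t = ≤∧≢⇒< (Invariant.some-unstarted inv) (t≢1 ∘ sym)
      pairs : ∀ i → coloured s₁ i ≡ 0 → r i ≡ 2
      pairs i unstarted with r i ≟ 2
      ... | yes r≡2 = r≡2
      ... | no  r≢2 = contradiction (i , unstarted , r≢2) noOtherSize

    replyToStarting : ∀ {s s₁ size} → InvariantAt s → StartingStep size (stats s) (stats s₁) →
                      2 ≤ size → size ≢ 3 → 1 ≤ unstartedParts s₁ → colours s₁ < c → BobKeepsInvariant s₁
    replyToStarting {s₁ = s₁} inv A 2≤size size≢3 1≤t₁ d₁<c with bobInStarted s₁ 1≤f₁ d₁<c
      where 1≤f₁ = subst (1 ≤_) (sym (StartingStep.f-inc A)) (≤-trans (∸-monoˡ-≤ 1 2≤size) (m≤n+m _ _))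
    ... | v , b , legal , B , fresh =
      v , b , legal , invariant-newPart-inStarted inv A 1≤t₁ B fresh 2≤size size≢3

    exhaustedOr : ∀ {P : Set} s₁ → (colours s₁ < c → P) → colours s₁ ≡ c ⊎ P
    exhaustedOr s₁ reply with colours s₁ ≟ c
    ... | yes d₁≡c = inj₁ d₁≡c
    ... | no  d₁≢c = inj₂ (reply (≤∧≢⇒< (colours≤c s₁) d₁≢c))

    GoodForBob : State → Set
    GoodForBob s₁ = 1 ≤ unstartedParts s₁ × (colours s₁ ≡ c ⊎ BobKeepsInvariant s₁)

    round : ∀ {s j y a} → InvariantAt s → Legal s (j , y) a → GoodForBob (update s (j , y) a)
    round {s} {j} {y} {a} inv legal@(free , _) with coloured s j in eq
    ... | suc _ = 1≤t₁ , exhaustedOr s' (replyToStarted inv A)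
      where
      open Colouring s j y a free
      A = startedStep eq
      1≤t₁ = subst (1 ≤_) (sym (StartedStep.t-same A)) (Invariant.some-unstarted inv)
    ... | zero = 1≤t₁ , exhaustedOr s' (replyToStarting inv A (r≥2 j) (r≢3 j) 1≤t₁)
      where
      open Colouring s j y a free
      A = startingStep eq (startingColour-fresh s j y a eq legal)
      1≤t₁ = n≢0⇒n>0 λ t₁≡0 → invariant-final inv (trans (sym (StartingStep.t-dec A)) (cong suc t₁≡0))
                                 (≤-trans (≤-reflexive (sym (StartingStep.d-inc A))) (colours≤c s'))

    bobWinsFrom : ∀ {s} → InvariantAt s → ¬ AliceWins s alice
    bobWinsFrom inv (finished allColoured) = unfinished _ (Invariant.some-unstarted inv) allColoured
    bobWinsFrom inv (aliceMove (j , y) a legal next) with round inv legal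
    ... | 1≤t₁ , inj₁ d₁≡c = bobHasWon d₁≡c 1≤t₁ next
    ... | 1≤t₁ , inj₂ (v , b , legal' , inv') with next
    ...   | finished allColoured = unfinished _ 1≤t₁ allColoured
    ...   | bobMove _ respond    = bobWinsFrom inv' (respond v b legal')

    bobWins : 1 ≤ k → suc c < k + k → (¬ 2 ∣ sum r → c < sum (λ i → ⌈ r i /2⌉)) → ¬ AliceWinsGame
    bobWins 1≤k 1+c<2k parity = bobWinsFrom (subst Invariant (sym stats-empty) record
      { some-unstarted = 1≤k
      ; colour-bound   = subst (_< k + k) (sym (+-identityʳ (suc c))) 1+c<2k
      ; parity-bound   = subst (c <_) (sym (+-identityʳ _)) ∘ parity
      })

m<2n∸1⇒1+m<n+n : ∀ {m} n → m < 2 * n ∸ 1 → suc m < n + n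
m<2n∸1⇒1+m<n+n {m} (suc n) m<2n∸1 =
  s≤s (subst (suc m ≤_) (cong (λ x → n + suc x) (+-identityʳ n)) m<2n∸1)

corollary5 : (k : ℕ) (r : Fin k → ℕ) → 3 ≤ k → (∀ j → 2 ≤ r j) → (∀ j → r j ≢ 3) →
    χg≥ (completeMultipartite k r) ((2 * k ∸ 1) ⊓ sumFin k (λ i → ⌈ r i /2⌉))
    × (2 ∣ sumFin k r → χg≥ (completeMultipartite k r) (2 * k ∸ 1))
corollary5 k r 3≤k r≥2 r≢3 = belowMinimum , belowTwoK
  where
  open module Bob c = BobStrategy.Winning k r c r≥2 r≢3 using (bobWins)
  1≤k : 1 ≤ k
  1≤k = ≤-trans (s≤s z≤n) 3≤k
  belowMinimum : χg≥ (completeMultipartite k r) ((2 * k ∸ 1) ⊓ sumFin k (λ i → ⌈ r i /2⌉))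
  belowMinimum c c<min = bobWins c 1≤k (m<2n∸1⇒1+m<n+n k (m<n⊓o⇒m<n _ _ c<min))
    λ _ → subst (c <_) (sumFin≡sum k _) (m<n⊓o⇒m<o _ _ c<min)
  belowTwoK : 2 ∣ sumFin k r → χg≥ (completeMultipartite k r) (2 * k ∸ 1)
  belowTwoK 2∣n c c<2k∸1 = bobWins c 1≤k (m<2n∸1⇒1+m<n+n k c<2k∸1)
    λ 2∤n → contradiction (subst (2 ∣_) (sumFin≡sum k r) 2∣n) 2∤n
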